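{- Let $n\ge3$, let $i\ne j$ in $[n]$, and let $F$ be a facet of $\hat{\mathcal{E}}_n$. If $e(F)=e(\mathbf{N}_{ij})$, then $F=\mathbf{N}_{ij}$.
   Context: Let $N_n=\{(r,s):1\le r,s\le n,\ r\ne s\}$; elements of $\mathbb{R}^{N_n}$ are $n\times n$ real matrices with the diagonal omitted. $\hat{\mathcal{E}}_n$ is the set of $x\in\mathbb{R}^{N_n}$ with $T_{rst}: x_{rs}+x_{st}-x_{rt}\ge0$ and $N_{rs}: x_{rs}\ge0$ for all pairwise distinct $r,s,t$. $\mathbf{N}_{rs}=\{x\in\hat{\mathcal{E}}_n:x_{rs}=0\}$ and $\mathbf{T}_{rst}=\{x\in\hat{\mathcal{E}}_n: x_{rs}+x_{st}-x_{rt}=0\}$; a facet is a maximal proper face of the cone. For $r\in[n]$, $R^{(r)}$ is the matrix with all off-diagonal entries of row $r$ equal to $1$ and all other entries $0$; $C^{(r)}$ is the analogous matrix for column $r$. Let $\mathscr{L}_n=\{R^{(r)},C^{(r)}:1\le r\le n\}$ (the lines). For a facet $F$, $e(F)=\{L\in\mathscr{L}_n: L\in F\}$.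
   Formalization: Points of $\hat{\mathcal{E}}_n$, of its faces and of its facets have rational coordinates instead of real ones, and the supporting hyperplanes defining faces have rational coefficients. -}

module Defs where

open import Data.Nat using (ℕ; zero; suc)
open import Data.Fin using (Fin; zero; suc; _≟_)
open import Data.Rational using (ℚ; 0ℚ; 1ℚ; _+_; _-_; _*_; _≤_)
open import Data.Product using (Σ; _×_; _,_)
open import Data.Bool using (if_then_else_; _∧_; not)
open import Relation.Nullary using (¬_)
open import Relation.Nullary.Decidable using (⌊_⌋)
open import Relation.Binary.PropositionalEquality using (_≡_; _≢_)

-- Rational version of the ambient space: an n×n matrix; the diagonal is
-- forced to be 0 inside the cone, so the cone lives in a copy of ℚ^{N_n}.
Mat : ℕ → Set
Mat n = Fin n → Fin n → ℚ

Pred : ℕ → Set₁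
Pred n = Mat n → Set

_≐_ : {n : ℕ} → Pred n → Pred n → Set
_≐_ {n} P Q = (x : Mat n) → (P x → Q x) × (Q x → P x)

_⊆_ : {n : ℕ} → Pred n → Pred n → Set
_⊆_ {n} P Q = (x : Mat n) → P x → Q x

sumFin : {n : ℕ} → (Fin n → ℚ) → ℚ
sumFin {zero}  f = 0ℚ
sumFin {suc n} f = f zero + sumFin (λ i → f (suc i))

offTerm : {n : ℕ} → Mat n → Mat n → Fin n → Fin n → ℚ
offTerm a x r s = if ⌊ r ≟ s ⌋ then 0ℚ else (a r s * x r s)

pairing : {n : ℕ} → Mat n → Mat n → ℚ
pairing a x = sumFin (λ r → sumFin (λ s → offTerm a x r s))

InCone : {n : ℕ} → Pred n
InCone {n} x =
  ((r : Fin n) → x r r ≡ 0ℚ) ×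
  (((r s t : Fin n) → r ≢ s → s ≢ t → r ≢ t → 0ℚ ≤ (x r s + x s t) - x r t) ×
   ((r s : Fin n) → r ≢ s → 0ℚ ≤ x r s))

IsFace : {n : ℕ} → Pred n → Set
IsFace {n} F = Σ (Mat n) λ a →
  ((x : Mat n) → InCone x → 0ℚ ≤ pairing a x) ×
  ((x : Mat n) → (F x → InCone x × pairing a x ≡ 0ℚ) ×
                 (InCone x × pairing a x ≡ 0ℚ → F x))

IsProper : {n : ℕ} → Pred n → Set
IsProper {n} F = ¬ (InCone ⊆ F)

IsFacet : {n : ℕ} → Pred n → Set₁
IsFacet {n} F = IsFace F × IsProper F ×
  ((G : Pred n) → IsFace G → IsProper G → F ⊆ G → G ⊆ F)

NFace : {n : ℕ} → Fin n → Fin n → Pred n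
NFace i j x = InCone x × x i j ≡ 0ℚ

data Line (n : ℕ) : Set where
  row : Fin n → Line n
  col : Fin n → Line n

lineMat : {n : ℕ} → Line n → Mat n
lineMat (row r) p q = if ⌊ p ≟ r ⌋ ∧ not ⌊ q ≟ r ⌋ then 1ℚ else 0ℚ
lineMat (col r) p q = if ⌊ q ≟ r ⌋ ∧ not ⌊ p ≟ r ⌋ then 1ℚ else 0ℚ

-- e(F) = e(G): the same lines lie in F and in G
SameLines : {n : ℕ} → Pred n → Pred n → Set
SameLines {n} F G = (L : Line n) → (F (lineMat L) → G (lineMat L)) × (G (lineMat L) → F (lineMat L))

{-# OPTIONS --safe #-}
-- Suppose the facet F, cut out by the supporting functional a, contains a point x
-- with c = x_ij > 0.  Put D = Σ_{t ≠ j} C^(t) and Δ = D − R^(i).  Off the diagonal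
-- Δ_pq = [q ≠ j] − [p = i] is a sum of a function of p and a function of q, so its
-- triangle defect Δ_ps + Δ_st − Δ_pt is [s ≠ j] − [s = i] ≥ 0; and Δ_pq ≥ 0 except
-- Δ_ij = −1.  Hence x + cΔ lies in the cone.  The columns C^(t), t ≠ j, lie in N_ij,
-- hence in F, so a·D = 0 and
--   0 = a·x + c a·D = a·(x + cΔ) + c a·R^(i),
-- a sum of two nonnegative numbers.  So a·R^(i) = 0, i.e. R^(i) ∈ F, although R^(i)
-- is not in N_ij.  Therefore F ⊆ N_ij, and maximality of F gives equality.
module Submission where

open import Defs
open import Data.Nat using (ℕ; _≤_)
open import Data.Fin using (Fin)
open import Relation.Binary.PropositionalEquality using (_≢_)

open import Algebra.Bundles using (CommutativeMonoid; CommutativeRing)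
open import Data.Bool using (Bool; true; false; if_then_else_; not)
open import Data.Empty using (⊥-elim)
open import Data.Fin using (zero; suc; punchIn; _≟_)
open import Data.Fin.Properties using (punchInᵢ≢i)
open import Data.Nat using (zero; suc)
open import Data.Product using (_×_; _,_; proj₁; proj₂; map₂)
open import Data.Rational using (ℚ; 0ℚ; 1ℚ; _+_; _-_; _*_; -_; 1/_; NonZero)
  renaming (_≤_ to _≤ℚ_)
open import Data.Rational.Base using (nonNegative; ≢-nonZero)
open import Data.Rational.Properties
  using ( 1≢0; ≤ᵇ⇒≤; ≤-antisym; ≤-reflexive; +-mono-≤; +-monoˡ-≤; *-monoˡ-≤-nonNeg
        ; +-identityˡ; +-identityʳ; +-comm; *-identityˡ; *-identityʳ; *-zeroˡ; *-zeroʳ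
        ; *-assoc; *-inverseˡ; *-distribˡ-+; *-1-commutativeMonoid; +-*-commutativeRing; module ≤-Reasoning)
  renaming (_≟_ to _≟ℚ_)
open import Data.Rational.Solver using (module +-*-Solver)
open import Data.Unit using (tt)
open import Function using (_∘_)
open import Relation.Nullary using (¬_; yes; no)
open import Relation.Nullary.Decidable using (⌊_⌋)
open import Relation.Binary.PropositionalEquality
  using (_≡_; refl; sym; trans; cong; cong₂; subst; ≡-≟-identity; ≢-≟-identity; module ≡-Reasoning)
open import Algebra.Properties.Semiring.Sum (CommutativeRing.semiring +-*-commutativeRing)
  using (sum; sum-cong-≗; sum-replicate-zero; sum-remove; ∑-distrib-+; ∑-comm; *-distribˡ-sum)

open import Algebra.Properties.CommutativeSemigroup (CommutativeMonoid.commutativeSemigroup *-1-commutativeMonoid)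
  using (x∙yz≈y∙xz)

open +-*-Solver using (solve; _:+_; _:-_; _:*_; :-_; con; _:=_)

private
  variable
    n : ℕ
    p q : ℚ

ind : Bool → ℚ
ind b = if b then 1ℚ else 0ℚ

ind-nonNeg : ∀ b → 0ℚ ≤ℚ ind b
ind-nonNeg true  = ≤ᵇ⇒≤ tt
ind-nonNeg false = ≤ᵇ⇒≤ tt

ind-≟-≡ : (r : Fin n) → ind ⌊ r ≟ r ⌋ ≡ 1ℚ
ind-≟-≡ r = cong (ind ∘ ⌊_⌋) (≡-≟-identity _≟_ refl)

ind-≟-≢ : {r s : Fin n} → r ≢ s → ind ⌊ r ≟ s ⌋ ≡ 0ℚ
ind-≟-≢ r≢s = cong (ind ∘ ⌊_⌋) (≢-≟-identity _≟_ r≢s)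

*-nonNeg : 0ℚ ≤ℚ p → 0ℚ ≤ℚ q → 0ℚ ≤ℚ p * q
*-nonNeg {p} {q} 0≤p 0≤q = begin
  0ℚ     ≡⟨ sym (*-zeroʳ p) ⟩
  p * 0ℚ ≤⟨ *-monoˡ-≤-nonNeg p {{nonNegative 0≤p}} 0≤q ⟩
  p * q  ∎
  where open ≤-Reasoning

p+q≡0⇒q≡0 : 0ℚ ≤ℚ p → 0ℚ ≤ℚ q → p + q ≡ 0ℚ → q ≡ 0ℚ
p+q≡0⇒q≡0 {p} {q} 0≤p 0≤q p+q≡0 = ≤-antisym q≤0 0≤q
  where
  open ≤-Reasoning
  q≤0 : q ≤ℚ 0ℚ
  q≤0 = begin
    q      ≡⟨ sym (+-identityˡ q) ⟩
    0ℚ + q ≤⟨ +-monoˡ-≤ q 0≤p ⟩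
    p + q  ≡⟨ p+q≡0 ⟩
    0ℚ     ∎

p*q≡0⇒q≡0 : p ≢ 0ℚ → p * q ≡ 0ℚ → q ≡ 0ℚ
p*q≡0⇒q≡0 {p} {q} p≢0 p*q≡0 = begin
  q              ≡⟨ sym (*-identityˡ q) ⟩
  1ℚ * q         ≡⟨ cong (_* q) (sym (*-inverseˡ p)) ⟩
  (1/ p * p) * q ≡⟨ *-assoc (1/ p) p q ⟩
  1/ p * (p * q) ≡⟨ cong (1/ p *_) p*q≡0 ⟩
  1/ p * 0ℚ      ≡⟨ *-zeroʳ (1/ p) ⟩
  0ℚ             ∎
  where
  open ≡-Reasoning
  instance
    p≢0′ : NonZero p
    p≢0′ = ≢-nonZero p≢0

sum-single : (f : Fin n → ℚ) (r : Fin n) → (∀ s → s ≢ r → f s ≡ 0ℚ) → sum f ≡ f r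
sum-single {suc n} f r vanish = begin
  sum f                                  ≡⟨ sum-remove {i = r} f ⟩
  f r + sum (f ∘ punchIn r)              ≡⟨ cong (f r +_) (sum-cong-≗ (λ s → vanish _ (punchInᵢ≢i r s))) ⟩
  f r + sum {n} (λ _ → 0ℚ)               ≡⟨ cong (f r +_) (sum-replicate-zero n) ⟩
  f r + 0ℚ                               ≡⟨ +-identityʳ (f r) ⟩
  f r                                    ∎
  where open ≡-Reasoning

sumFin≡sum : (f : Fin n → ℚ) → sumFin f ≡ sum f
sumFin≡sum {zero}  f = refl
sumFin≡sum {suc n} f = cong (f zero +_) (sumFin≡sum (f ∘ suc))

infixl 6 _⊕_ _⊖_
infixl 7 _⊛_ _⊙_

_⊕_ _⊖_ : Mat n → Mat n → Mat n
(x ⊕ y) r s = x r s + y r s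
(x ⊖ y) r s = x r s - y r s

_⊛_ : ℚ → Mat n → Mat n
(c ⊛ x) r s = c * x r s

_⊙_ : Mat n → Mat n → Mat n
(x ⊙ y) r s = x r s * y r s

sumMat : (Fin n → Mat n) → Mat n
sumMat f r s = sum λ t → f t r s

∑∑ : (Fin n → Fin n → ℚ) → ℚ
∑∑ f = sum λ r → sum (f r)

offDiagonal : Mat n → Mat n
offDiagonal a r s = if ⌊ r ≟ s ⌋ then 0ℚ else a r s

offDiagonal-≢ : (a : Mat n) {r s : Fin n} → r ≢ s → offDiagonal a r s ≡ a r s
offDiagonal-≢ a {r} {s} r≢s = cong (λ d → if ⌊ d ⌋ then 0ℚ else a r s) (≢-≟-identity _≟_ r≢s)

offDiagonal-zero : (a : Mat n) {r s : Fin n} → a r s ≡ 0ℚ → offDiagonal a r s ≡ 0ℚ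
offDiagonal-zero a {r} {s} a≡0 with r ≟ s
... | yes _ = refl
... | no  _ = a≡0

module _ (a : Mat n) where
  open ≡-Reasoning

  private
    ã : Mat n
    ã = offDiagonal a

  pairing≡∑∑ : (x : Mat n) → pairing a x ≡ ∑∑ (offDiagonal a ⊙ x)
  pairing≡∑∑ x = trans (sumFin≡sum (λ r → sumFin (offTerm a x r)))
                       (sum-cong-≗ λ r → trans (sumFin≡sum (offTerm a x r)) (sum-cong-≗ (offTerm≡ r)))
    where
    offTerm≡ : ∀ r s → offTerm a x r s ≡ ã r s * x r s
    offTerm≡ r s with r ≟ s
    ... | yes _ = sym (*-zeroˡ (x r s))
    ... | no  _ = refl

  pairing-cong : {x y : Mat n} → (∀ r s → x r s ≡ y r s) → pairing a x ≡ pairing a y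
  pairing-cong {x} {y} x≗y = begin
    pairing a x   ≡⟨ pairing≡∑∑ x ⟩
    ∑∑ (ã ⊙ x)    ≡⟨ sum-cong-≗ (λ r → sum-cong-≗ (λ s → cong (ã r s *_) (x≗y r s))) ⟩
    ∑∑ (ã ⊙ y)    ≡⟨ pairing≡∑∑ y ⟨
    pairing a y   ∎

  pairing-⊕ : (x y : Mat n) → pairing a (x ⊕ y) ≡ pairing a x + pairing a y
  pairing-⊕ x y = begin
    pairing a (x ⊕ y)
      ≡⟨ pairing≡∑∑ (x ⊕ y) ⟩
    ∑∑ (ã ⊙ (x ⊕ y))
      ≡⟨ sum-cong-≗ (λ r → sum-cong-≗ (λ s → *-distribˡ-+ (ã r s) (x r s) (y r s))) ⟩
    ∑∑ (ã ⊙ x ⊕ ã ⊙ y)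
      ≡⟨ sum-cong-≗ (λ r → ∑-distrib-+ ((ã ⊙ x) r) ((ã ⊙ y) r)) ⟩
    (sum λ r → sum ((ã ⊙ x) r) + sum ((ã ⊙ y) r))
      ≡⟨ ∑-distrib-+ (λ r → sum ((ã ⊙ x) r)) (λ r → sum ((ã ⊙ y) r)) ⟩
    ∑∑ (ã ⊙ x) + ∑∑ (ã ⊙ y)
      ≡⟨ cong₂ _+_ (pairing≡∑∑ x) (pairing≡∑∑ y) ⟨
    pairing a x + pairing a y
      ∎

  pairing-⊛ : (c : ℚ) (x : Mat n) → pairing a (c ⊛ x) ≡ c * pairing a x
  pairing-⊛ c x = begin
    pairing a (c ⊛ x)
      ≡⟨ pairing≡∑∑ (c ⊛ x) ⟩
    ∑∑ (ã ⊙ (c ⊛ x))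
      ≡⟨ sum-cong-≗ (λ r → sum-cong-≗ (λ s → x∙yz≈y∙xz (ã r s) c (x r s))) ⟩
    ∑∑ (c ⊛ (ã ⊙ x))
      ≡⟨ sum-cong-≗ (λ r → *-distribˡ-sum c ((ã ⊙ x) r)) ⟨
    (sum λ r → c * sum ((ã ⊙ x) r))
      ≡⟨ *-distribˡ-sum c (λ r → sum ((ã ⊙ x) r)) ⟨
    c * ∑∑ (ã ⊙ x)
      ≡⟨ cong (c *_) (pairing≡∑∑ x) ⟨
    c * pairing a x
      ∎

  pairing-sumMat : (f : Fin n → Mat n) → pairing a (sumMat f) ≡ sum λ t → pairing a (f t)
  pairing-sumMat f = begin
    pairing a (sumMat f)
      ≡⟨ pairing≡∑∑ (sumMat f) ⟩
    ∑∑ (ã ⊙ sumMat f)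
      ≡⟨ sum-cong-≗ (λ r → sum-cong-≗ (λ s → *-distribˡ-sum (ã r s) (λ t → f t r s))) ⟩
    ∑∑ (sumMat λ t → ã ⊙ f t)
      ≡⟨ sum-cong-≗ (λ r → ∑-comm (λ s t → (ã ⊙ f t) r s)) ⟩
    (sum λ r → sum λ t → sum λ s → (ã ⊙ f t) r s)
      ≡⟨ ∑-comm (λ r t → sum ((ã ⊙ f t) r)) ⟩
    (sum λ t → ∑∑ (ã ⊙ f t))
      ≡⟨ sum-cong-≗ (pairing≡∑∑ ∘ f) ⟨
    (sum λ t → pairing a (f t))
      ∎

  pairing-⊕⊛ : (x : Mat n) (c : ℚ) (y : Mat n) → pairing a (x ⊕ c ⊛ y) ≡ pairing a x + c * pairing a y
  pairing-⊕⊛ x c y = trans (pairing-⊕ x (c ⊛ y)) (cong (pairing a x +_) (pairing-⊛ c y))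

unitMat : Fin n → Fin n → Mat n
unitMat i j r s = ind ⌊ r ≟ i ⌋ * ind ⌊ s ≟ j ⌋

pairing-unitMat : {i j : Fin n} → i ≢ j → (y : Mat n) → pairing (unitMat i j) y ≡ y i j
pairing-unitMat {n} {i} {j} i≢j y = begin
  pairing (unitMat i j) y  ≡⟨ pairing≡∑∑ (unitMat i j) y ⟩
  (∑∑ λ r s → term r s)    ≡⟨ sum-single _ i outside-row ⟩
  (sum λ s → term i s)     ≡⟨ sum-single _ j outside-col ⟩
  term i j                 ≡⟨ cong (_* y i j) (offDiagonal-≢ (unitMat i j) i≢j) ⟩
  unitMat i j i j * y i j  ≡⟨ cong (_* y i j) (cong₂ _*_ (ind-≟-≡ i) (ind-≟-≡ j)) ⟩
  1ℚ * y i j               ≡⟨ *-identityˡ (y i j) ⟩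
  y i j                    ∎
  where
  open ≡-Reasoning
  term : Fin n → Fin n → ℚ
  term r s = offDiagonal (unitMat i j) r s * y r s
  term≡0 : ∀ r s → unitMat i j r s ≡ 0ℚ → term r s ≡ 0ℚ
  term≡0 r s e = trans (cong (_* y r s) (offDiagonal-zero (unitMat i j) {r} {s} e)) (*-zeroˡ (y r s))
  outside-row : ∀ r → r ≢ i → (sum λ s → term r s) ≡ 0ℚ
  outside-row r r≢i = trans (sum-cong-≗ λ s → term≡0 r s (first≡0 s)) (sum-replicate-zero n)
    where
    first≡0 : ∀ s → unitMat i j r s ≡ 0ℚ
    first≡0 s = trans (cong (_* ind ⌊ s ≟ j ⌋) (ind-≟-≢ r≢i)) (*-zeroˡ (ind ⌊ s ≟ j ⌋))
  outside-col : ∀ s → s ≢ j → term i s ≡ 0ℚ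
  outside-col s s≢j = term≡0 i s (trans (cong (ind ⌊ i ≟ i ⌋ *_) (ind-≟-≢ s≢j)) (*-zeroʳ (ind ⌊ i ≟ i ⌋)))

row-offDiag : (r : Fin n) {p q : Fin n} → p ≢ q → lineMat (row r) p q ≡ ind ⌊ p ≟ r ⌋
row-offDiag r {p} {q} p≢q with p ≟ r | q ≟ r
... | yes refl | yes refl = ⊥-elim (p≢q refl)
... | yes _    | no _     = refl
... | no _     | _        = refl

col-offDiag : (r : Fin n) {p q : Fin n} → p ≢ q → lineMat (col r) p q ≡ ind ⌊ q ≟ r ⌋
col-offDiag r {p} {q} p≢q with q ≟ r | p ≟ r
... | yes refl | yes refl = ⊥-elim (p≢q refl)
... | yes _    | no _     = refl
... | no _     | _        = refl

line-diag : (L : Line n) (p : Fin n) → lineMat L p p ≡ 0ℚ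
line-diag (row r) p with p ≟ r
... | yes _ = refl
... | no  _ = refl
line-diag (col r) p with p ≟ r
... | yes _ = refl
... | no  _ = refl

defect : Mat n → Fin n → Fin n → Fin n → ℚ
defect x r s t = (x r s + x s t) - x r t

Triangular : Mat n → Set
Triangular {n} x = (r s t : Fin n) → r ≢ s → s ≢ t → r ≢ t → 0ℚ ≤ℚ defect x r s t

separable-triangular : {x : Mat n} (u v : Fin n → ℚ) → (∀ p q → p ≢ q → x p q ≡ u p + v q) →
                       (∀ s → 0ℚ ≤ℚ u s + v s) → Triangular x
separable-triangular {x = x} u v x≡u+v middle≥0 r s t r≢s s≢t r≢t =
  subst (0ℚ ≤ℚ_) (sym defect≡) (middle≥0 s)
  where
  open ≡-Reasoning
  telescope : ∀ ur us vs vt → ((ur + vs) + (us + vt)) - (ur + vt) ≡ us + vs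
  telescope = solve 4 (λ ur us vs vt → ((ur :+ vs) :+ (us :+ vt)) :- (ur :+ vt) := us :+ vs) refl
  defect≡ : defect x r s t ≡ u s + v s
  defect≡ = begin
    defect x r s t
      ≡⟨ cong₂ _-_ (cong₂ _+_ (x≡u+v r s r≢s) (x≡u+v s t s≢t)) (x≡u+v r t r≢t) ⟩
    ((u r + v s) + (u s + v t)) - (u r + v t)
      ≡⟨ telescope (u r) (u s) (v s) (v t) ⟩
    u s + v s
      ∎

triangular-⊕⊛ : {x y : Mat n} {c : ℚ} → Triangular x → 0ℚ ≤ℚ c → Triangular y → Triangular (x ⊕ c ⊛ y)
triangular-⊕⊛ {x = x} {y} {c} x-tri 0≤c y-tri r s t r≢s s≢t r≢t =
  subst (0ℚ ≤ℚ_) (sym (split (x r s) (x s t) (x r t) (y r s) (y s t) (y r t)))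
    (+-mono-≤ (x-tri r s t r≢s s≢t r≢t) (*-nonNeg 0≤c (y-tri r s t r≢s s≢t r≢t)))
  where
  split : ∀ x₁ x₂ x₃ y₁ y₂ y₃ →
    ((x₁ + c * y₁) + (x₂ + c * y₂)) - (x₃ + c * y₃) ≡ ((x₁ + x₂) - x₃) + c * ((y₁ + y₂) - y₃)
  split x₁ x₂ x₃ y₁ y₂ y₃ = solve 7 (λ c x₁ x₂ x₃ y₁ y₂ y₃ →
      ((x₁ :+ c :* y₁) :+ (x₂ :+ c :* y₂)) :- (x₃ :+ c :* y₃)
      := ((x₁ :+ x₂) :- x₃) :+ c :* ((y₁ :+ y₂) :- y₃))
    refl c x₁ x₂ x₃ y₁ y₂ y₃

line∈cone : (L : Line n) → InCone (lineMat L)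
line∈cone L@(row r) =
  line-diag L , separable-triangular (λ p → ind ⌊ p ≟ r ⌋) (λ _ → 0ℚ) entry middle≥0 , λ _ _ _ → ind-nonNeg _
  where
  entry : ∀ p q → p ≢ q → lineMat L p q ≡ ind ⌊ p ≟ r ⌋ + 0ℚ
  entry p q p≢q = trans (row-offDiag r p≢q) (sym (+-identityʳ _))
  middle≥0 : ∀ s → 0ℚ ≤ℚ ind ⌊ s ≟ r ⌋ + 0ℚ
  middle≥0 s = subst (0ℚ ≤ℚ_) (sym (+-identityʳ _)) (ind-nonNeg ⌊ s ≟ r ⌋)
line∈cone L@(col r) =
  line-diag L , separable-triangular (λ _ → 0ℚ) (λ q → ind ⌊ q ≟ r ⌋) entry middle≥0 , λ _ _ _ → ind-nonNeg _
  where
  entry : ∀ p q → p ≢ q → lineMat L p q ≡ 0ℚ + ind ⌊ q ≟ r ⌋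
  entry p q p≢q = trans (col-offDiag r p≢q) (sym (+-identityˡ _))
  middle≥0 : ∀ s → 0ℚ ≤ℚ 0ℚ + ind ⌊ s ≟ r ⌋
  middle≥0 s = subst (0ℚ ≤ℚ_) (sym (+-identityˡ _)) (ind-nonNeg ⌊ s ≟ r ⌋)

columnSum : (Fin n → ℚ) → Mat n
columnSum v = sumMat λ t → v t ⊛ lineMat (col t)

columnSum-offDiag : (v : Fin n → ℚ) {p q : Fin n} → p ≢ q → columnSum v p q ≡ v q
columnSum-offDiag v {p} {q} p≢q = begin
  (sum λ t → v t * lineMat (col t) p q)  ≡⟨ sum-single _ q other-column ⟩
  v q * lineMat (col q) p q              ≡⟨ cong (v q *_) (trans (col-offDiag q p≢q) (ind-≟-≡ q)) ⟩
  v q * 1ℚ                               ≡⟨ *-identityʳ (v q) ⟩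
  v q                                    ∎
  where
  open ≡-Reasoning
  other-column : ∀ t → t ≢ q → v t * lineMat (col t) p q ≡ 0ℚ
  other-column t t≢q =
    trans (cong (v t *_) (trans (col-offDiag t p≢q) (ind-≟-≢ (t≢q ∘ sym)))) (*-zeroʳ (v t))

columnSum-diag : (v : Fin n → ℚ) (p : Fin n) → columnSum v p p ≡ 0ℚ
columnSum-diag {n} v p =
  trans (sum-cong-≗ λ t → trans (cong (v t *_) (line-diag (col t) p)) (*-zeroʳ (v t))) (sum-replicate-zero n)

pairing-columnSum : (a : Mat n) (v : Fin n → ℚ) →
                    pairing a (columnSum v) ≡ sum λ t → v t * pairing a (lineMat (col t))
pairing-columnSum a v =
  trans (pairing-sumMat a (λ t → v t ⊛ lineMat (col t))) (sum-cong-≗ λ t → pairing-⊛ a (v t) (lineMat (col t)))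

otherColumns : Fin n → Mat n
otherColumns j = columnSum λ t → ind (not ⌊ t ≟ j ⌋)

pairing-otherColumns : (a : Mat n) {j : Fin n} → (∀ t → t ≢ j → pairing a (lineMat (col t)) ≡ 0ℚ) →
                       pairing a (otherColumns j) ≡ 0ℚ
pairing-otherColumns {n} a {j} a·cols≡0 =
  trans (pairing-columnSum a (λ t → ind (not ⌊ t ≟ j ⌋))) (trans (sum-cong-≗ term≡0) (sum-replicate-zero n))
  where
  term≡0 : ∀ t → ind (not ⌊ t ≟ j ⌋) * pairing a (lineMat (col t)) ≡ 0ℚ
  term≡0 t with t ≟ j
  ... | yes _   = *-zeroˡ (pairing a (lineMat (col t)))
  ... | no  t≢j = cong (1ℚ *_) (a·cols≡0 t t≢j)

Δ : Fin n → Fin n → Mat n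
Δ i j = otherColumns j ⊖ lineMat (row i)

Δ-offDiag : {i j p q : Fin n} → p ≢ q → Δ i j p q ≡ - ind ⌊ p ≟ i ⌋ + ind (not ⌊ q ≟ j ⌋)
Δ-offDiag {i = i} {j} {p} {q} p≢q =
  trans (cong₂ _-_ (columnSum-offDiag (λ t → ind (not ⌊ t ≟ j ⌋)) p≢q) (row-offDiag i p≢q))
        (+-comm (ind (not ⌊ q ≟ j ⌋)) (- ind ⌊ p ≟ i ⌋))

Δ-diag : {i j : Fin n} (p : Fin n) → Δ i j p p ≡ 0ℚ
Δ-diag {i = i} {j} p = cong₂ _-_ (columnSum-diag (λ t → ind (not ⌊ t ≟ j ⌋)) p) (line-diag (row i) p)

Δ-triangular : {i j : Fin n} → i ≢ j → Triangular (Δ i j)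
Δ-triangular {i = i} {j} i≢j =
  separable-triangular (λ p → - ind ⌊ p ≟ i ⌋) (λ q → ind (not ⌊ q ≟ j ⌋)) (λ _ _ → Δ-offDiag) middle≥0
  where
  middle≥0 : ∀ s → 0ℚ ≤ℚ - ind ⌊ s ≟ i ⌋ + ind (not ⌊ s ≟ j ⌋)
  middle≥0 s with s ≟ i | s ≟ j
  ... | yes refl | yes refl = ⊥-elim (i≢j refl)
  ... | yes _    | no _     = ≤ᵇ⇒≤ tt
  ... | no _     | yes _    = ≤ᵇ⇒≤ tt
  ... | no _     | no _     = ≤ᵇ⇒≤ tt

+Δ∈cone : {i j : Fin n} {x : Mat n} → i ≢ j → InCone x → InCone (x ⊕ x i j ⊛ Δ i j)
+Δ∈cone {i = i} {j} {x} i≢j (x-diag , x-tri , x-nonNeg) =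
  diag , triangular-⊕⊛ {x = x} {y = Δ i j} x-tri (x-nonNeg i j i≢j) (Δ-triangular i≢j) , nonNeg
  where
  c : ℚ
  c = x i j
  diag : ∀ p → x p p + c * Δ i j p p ≡ 0ℚ
  diag p = trans (cong₂ (λ u d → u + c * d) (x-diag p) (Δ-diag p)) (cong (0ℚ +_) (*-zeroʳ c))
  c-c≡0 : c + c * - 1ℚ ≡ 0ℚ
  c-c≡0 = solve 1 (λ c → c :+ c :* (:- con 1ℚ) := con 0ℚ) refl c
  x+c*d≥0 : ∀ p q → p ≢ q → {d : ℚ} → 0ℚ ≤ℚ d → 0ℚ ≤ℚ x p q + c * d
  x+c*d≥0 p q p≢q 0≤d = +-mono-≤ (x-nonNeg p q p≢q) (*-nonNeg (x-nonNeg i j i≢j) 0≤d)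
  entry : ∀ p q → p ≢ q → 0ℚ ≤ℚ x p q + c * (- ind ⌊ p ≟ i ⌋ + ind (not ⌊ q ≟ j ⌋))
  entry p q p≢q with p ≟ i | q ≟ j
  ... | yes refl | yes refl = ≤-reflexive (sym c-c≡0)
  ... | yes _    | no _     = x+c*d≥0 p q p≢q (≤ᵇ⇒≤ tt)
  ... | no _     | yes _    = x+c*d≥0 p q p≢q (≤ᵇ⇒≤ tt)
  ... | no _     | no _     = x+c*d≥0 p q p≢q (≤ᵇ⇒≤ tt)
  nonNeg : ∀ p q → p ≢ q → 0ℚ ≤ℚ x p q + c * Δ i j p q
  nonNeg p q p≢q = subst (λ d → 0ℚ ≤ℚ x p q + c * d) (sym (Δ-offDiag p≢q)) (entry p q p≢q)

row∈face : {F : Pred n} {i j : Fin n} → IsFace F → i ≢ j → (∀ t → t ≢ j → F (lineMat (col t))) →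
           {x : Mat n} → F x → x i j ≢ 0ℚ → F (lineMat (row i))
row∈face {n} {i = i} {j} (a , supporting , characterised) i≢j cols∈F {x} x∈F c≢0 =
  proj₂ (characterised R) (line∈cone (row i) , p*q≡0⇒q≡0 c≢0 c*aR≡0)
  where
  open ≡-Reasoning
  c : ℚ
  c = x i j
  R D : Mat n
  R = lineMat (row i)
  D = otherColumns j
  x∈cone : InCone x
  x∈cone = proj₁ (proj₁ (characterised x) x∈F)
  ax≡0 : pairing a x ≡ 0ℚ
  ax≡0 = proj₂ (proj₁ (characterised x) x∈F)
  aD≡0 : pairing a D ≡ 0ℚ
  aD≡0 = pairing-otherColumns a λ t t≢j → proj₂ (proj₁ (characterised _) (cols∈F t t≢j))
  regroup : ∀ p q → (x ⊕ c ⊛ Δ i j ⊕ c ⊛ R) p q ≡ (x ⊕ c ⊛ D) p q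
  regroup p q =
    solve 4 (λ x c d r → (x :+ c :* (d :- r)) :+ c :* r := x :+ c :* d) refl (x p q) c (D p q) (R p q)
  balance : pairing a (x ⊕ c ⊛ Δ i j) + c * pairing a R ≡ 0ℚ
  balance = begin
    pairing a (x ⊕ c ⊛ Δ i j) + c * pairing a R  ≡⟨ sym (pairing-⊕⊛ a (x ⊕ c ⊛ Δ i j) c R) ⟩
    pairing a (x ⊕ c ⊛ Δ i j ⊕ c ⊛ R)            ≡⟨ pairing-cong a regroup ⟩
    pairing a (x ⊕ c ⊛ D)                         ≡⟨ pairing-⊕⊛ a x c D ⟩
    pairing a x + c * pairing a D                 ≡⟨ cong₂ (λ u v → u + c * v) ax≡0 aD≡0 ⟩
    0ℚ + c * 0ℚ                                   ≡⟨ cong (0ℚ +_) (*-zeroʳ c) ⟩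
    0ℚ                                            ∎
  c*aR≡0 : c * pairing a R ≡ 0ℚ
  c*aR≡0 = p+q≡0⇒q≡0 (supporting _ (+Δ∈cone i≢j x∈cone))
                     (*-nonNeg (proj₂ (proj₂ x∈cone) i j i≢j) (supporting R (line∈cone (row i))))
                     balance

face⊆NFace : {F : Pred n} {i j : Fin n} → IsFace F → i ≢ j → (∀ t → t ≢ j → F (lineMat (col t))) →
             ¬ F (lineMat (row i)) → F ⊆ NFace i j
face⊆NFace {i = i} {j} face i≢j cols∈F row∉F x x∈F with x i j ≟ℚ 0ℚ
... | yes xij≡0 = proj₁ (proj₁ (proj₂ (proj₂ face) x) x∈F) , xij≡0
... | no  xij≢0 = ⊥-elim (row∉F (row∈face face i≢j cols∈F x∈F xij≢0))

NFace-isFace : {i j : Fin n} → i ≢ j → IsFace (NFace i j)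
NFace-isFace {i = i} {j} i≢j = unitMat i j , supporting , characterised
  where
  supporting : ∀ y → InCone y → 0ℚ ≤ℚ pairing (unitMat i j) y
  supporting y (_ , _ , y-nonNeg) = subst (0ℚ ≤ℚ_) (sym (pairing-unitMat i≢j y)) (y-nonNeg i j i≢j)
  characterised : ∀ y → (NFace i j y → InCone y × pairing (unitMat i j) y ≡ 0ℚ) ×
                         (InCone y × pairing (unitMat i j) y ≡ 0ℚ → NFace i j y)
  characterised y = map₂ (trans (pairing-unitMat i≢j y)) , map₂ (trans (sym (pairing-unitMat i≢j y)))

row∉NFace : {i j : Fin n} → i ≢ j → ¬ NFace i j (lineMat (row i))
row∉NFace {i = i} i≢j (_ , Rij≡0) = 1≢0 (trans (sym (trans (row-offDiag i i≢j) (ind-≟-≡ i))) Rij≡0)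

col∈NFace : {i j t : Fin n} → i ≢ j → t ≢ j → NFace i j (lineMat (col t))
col∈NFace {t = t} i≢j t≢j = line∈cone (col t) , trans (col-offDiag t i≢j) (ind-≟-≢ (t≢j ∘ sym))

NFace-isProper : {i j : Fin n} → i ≢ j → IsProper (NFace i j)
NFace-isProper i≢j cone⊆N = row∉NFace i≢j (cone⊆N _ (line∈cone (row _)))

facet-≐ : {F G : Pred n} → IsFacet F → IsFace G → IsProper G → F ⊆ G → F ≐ G
facet-≐ {G = G} (_ , _ , maximal) G-face G-proper F⊆G x = F⊆G x , maximal G G-face G-proper F⊆G x

mainTheorem6 : (n : ℕ) → 3 ≤ n → (i j : Fin n) → i ≢ j →
    (F : Pred n) → IsFacet F → SameLines F (NFace i j) → F ≐ NFace i j
mainTheorem6 n _ i j i≢j F F-facet same =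
  facet-≐ F-facet (NFace-isFace i≢j) (NFace-isProper i≢j)
    (face⊆NFace (proj₁ F-facet) i≢j cols∈F (row∉NFace i≢j ∘ proj₁ (same (row i))))
  where
  cols∈F : ∀ t → t ≢ j → F (lineMat (col t))
  cols∈F t t≢j = proj₂ (same (col t)) (col∈NFace i≢j t≢j)
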